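{- Let $p_1\neq p_2$ be primes, let $G,H\in K_1$ with $G\leq_{\mathbf{K}_1}H$, and let $a\in H\setminus G$. (1) If $G=p_1^\omega G$, then $\operatorname{cl}^H_{\mathbf{K}_1}(\{a\}\cup G)=\operatorname{cl}^H_{\mathbf{K}_{TF}}(\{a\}\cup G\cup p_2^\omega H)$. (2) If $G\neq p_1^\omega G$, then $\operatorname{cl}^H_{\mathbf{K}_1}(\{a\}\cup G)=\operatorname{cl}^H_{\mathbf{K}_{TF}}(\{a\}\cup G)$.
   Context: For a prime $p$ and group $G$, $p^\omega G:=\bigcap_{n<\omega}p^nG$; $\leq_p$ denotes pure subgroup. $K_1$ is the class of torsion-free abelian groups $G$ with $|p_1^\omega G|,|p_2^\omega G|\le\aleph_0$; for $G_1,G_2\in K_1$, $G_1\leq_{\mathbf{K}_1}G_2$ iff $G_1\leq_pG_2$, $p_1^\omega G_1=p_1^\omega G_2$, and either $G_1=p_1^\omega G_1$ or $p_2^\omega G_1=p_2^\omega G_2$. For $A\subseteq H$: $\operatorname{cl}^H_{\mathbf{K}_1}(A):=\bigcap\{G'\in K_1:A\subseteq G'\leq_{\mathbf{K}_1}H\}$ and $\operatorname{cl}^H_{\mathbf{K}_{TF}}(A):=\bigcap\{G'\text{ torsion-free}:A\subseteq G'\leq_pH\}$ (the pure closure of $A$ in $H$). -}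

module Defs where

open import Level using (Level; _⊔_; Lift)
open import Data.Nat using (ℕ; zero; suc; _^_)
open import Data.Nat.Primality using (Prime)
open import Data.Product using (Σ; ∃; _×_; proj₁)
open import Data.Sum using (_⊎_)
open import Data.Unit.Polymorphic using (⊤)
open import Relation.Nullary using (¬_)
open import Relation.Binary.PropositionalEquality using (_≡_; _≢_)
open import Relation.Unary using (Pred)
open import Algebra.Bundles using (AbelianGroup)

module AG {c ℓ : Level} (H : AbelianGroup c ℓ) where
  open AbelianGroup H

  Subset : Set (Level.suc (c ⊔ ℓ))
  Subset = Pred Carrier (c ⊔ ℓ)

  infixr 8 _·_
  _·_ : ℕ → Carrier → Carrier
  zero  · x = ε
  suc n · x = x ∙ (n · x)

  Full : Subset
  Full _ = ⊤

  _⊆ₛ_ : Subset → Subset → Set (c ⊔ ℓ)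
  A ⊆ₛ B = ∀ x → A x → B x

  _≐_ : Subset → Subset → Set (c ⊔ ℓ)
  A ≐ B = (A ⊆ₛ B) × (B ⊆ₛ A)

  _∪_ : Subset → Subset → Subset
  (A ∪ B) x = A x ⊎ B x

  ⟨_⟩ : Carrier → Subset
  ⟨ a ⟩ x = Lift c (x ≈ a)

  record IsSubgroup (G : Subset) : Set (c ⊔ ℓ) where
    field
      resp  : ∀ {x y} → x ≈ y → G x → G y
      has-ε : G ε
      ∙-cl  : ∀ {x y} → G x → G y → G (x ∙ y)
      ⁻¹-cl : ∀ {x} → G x → G (x ⁻¹)

  TorsionFree : Set (c ⊔ ℓ)
  TorsionFree = ∀ (n : ℕ) (x : Carrier) → n · x ≈ ε → (n ≡ 0) ⊎ (x ≈ ε)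

  _^_·ₛ_ : ℕ → ℕ → Subset → Subset
  (p ^ n ·ₛ G) x = ∃ λ y → G y × (x ≈ (p ^ n) · y)

  _^ω_ : ℕ → Subset → Subset
  (p ^ω G) x = ∀ (n : ℕ) → (p ^ n ·ₛ G) x

  Countable : Subset → Set (c ⊔ ℓ)
  Countable A = Σ (Σ Carrier A → ℕ) λ f →
    ∀ (u v : Σ Carrier A) → f u ≡ f v → proj₁ u ≈ proj₁ v

  Pure : Subset → Subset → Set (c ⊔ ℓ)
  Pure G₁ G₂ = (G₁ ⊆ₛ G₂) × (∀ (n : ℕ) (x y : Carrier) → G₁ x → G₂ y → x ≈ n · y →
                                ∃ λ z → G₁ z × (x ≈ n · z))

  module K1 (p₁ p₂ : ℕ) where
    -- G ∈ K₁ (for a subgroup G of the torsion-free group H,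
    -- torsion-freeness of G is inherited from H)
    InK1 : Subset → Set (c ⊔ ℓ)
    InK1 G = IsSubgroup G × Countable (p₁ ^ω G) × Countable (p₂ ^ω G)

    _≤K1_ : Subset → Subset → Set (c ⊔ ℓ)
    G₁ ≤K1 G₂ = Pure G₁ G₂ × ((p₁ ^ω G₁) ≐ (p₁ ^ω G₂))
                × ((G₁ ≐ (p₁ ^ω G₁)) ⊎ ((p₂ ^ω G₁) ≐ (p₂ ^ω G₂)))

    clK1 : Subset → Carrier → Set (Level.suc (c ⊔ ℓ))
    clK1 A x = ∀ (G' : Subset) → InK1 G' → A ⊆ₛ G' → G' ≤K1 Full → G' x

  clTF : Subset → Carrier → Set (Level.suc (c ⊔ ℓ))
  clTF A x = ∀ (G' : Subset) → IsSubgroup G' → A ⊆ₛ G' → Pure G' Full → G' x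

{-# OPTIONS --safe #-}
-- A pure subgroup G′ of H lies in K₁ automatically (its p^ω-parts sit inside those of H), and it
-- is ≤K₁ H as soon as it contains both p₁^ω H and p₂^ω H, because purity then gives
-- p^ω G′ = p^ω H. Since G ≤K₁ H, p₁^ω H = p₁^ω G ⊆ G, so only p₂^ω H matters. Conversely a
-- K₁-substructure G′ of H either satisfies G′ = p₁^ω G′ ⊆ p₁^ω H ⊆ G, impossible when a ∈ G′,
-- or contains p₂^ω H. Hence the K₁-closed subgroups above {a} ∪ G are exactly the pure
-- subgroups above {a} ∪ G ∪ p₂^ω H. When G ≠ p₁^ω G, the relation G ≤K₁ H already puts
-- p₂^ω H inside G, which gives (2).
module Submission where

open import Defs
open import Level using (Level; lift)
open import Data.Nat using (ℕ; _^_)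
open import Data.Nat.Primality using (Prime)
open import Data.Product using (_×_; _,_; proj₁)
open import Data.Sum using (_⊎_; inj₁; inj₂; [_,_])
open import Function using (_∘_)
open import Relation.Nullary using (¬_; contradiction)
open import Relation.Binary.PropositionalEquality using (_≢_)
open import Function.Bundles using (_⇔_; mk⇔)
open import Algebra.Bundles using (AbelianGroup)

module Subsets {c ℓ : Level} (H : AbelianGroup c ℓ) where
  open AbelianGroup H
  open AG H

  ⊆ₛ-trans : {A B C : Subset} → A ⊆ₛ B → B ⊆ₛ C → A ⊆ₛ C
  ⊆ₛ-trans A⊆B B⊆C x = B⊆C x ∘ A⊆B x

  ⊆-Full : {A : Subset} → A ⊆ₛ Full
  ⊆-Full _ _ = _

  ⊆-∪ˡ : {A B : Subset} → A ⊆ₛ (A ∪ B)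
  ⊆-∪ˡ _ = inj₁

  ⊆-∪ʳ : {A B : Subset} → B ⊆ₛ (A ∪ B)
  ⊆-∪ʳ _ = inj₂

  ∪-⊆ : {A B C : Subset} → A ⊆ₛ C → B ⊆ₛ C → (A ∪ B) ⊆ₛ C
  ∪-⊆ A⊆C B⊆C x = [ A⊆C x , B⊆C x ]

  ^ω-mono : {A B : Subset} (p : ℕ) → A ⊆ₛ B → (p ^ω A) ⊆ₛ (p ^ω B)
  ^ω-mono p A⊆B x x∈pωA n with x∈pωA n
  ... | y , Ay , x≈pⁿy = y , A⊆B y Ay , x≈pⁿy

  ^ω⊆ : {A : Subset} (p : ℕ) → IsSubgroup A → (p ^ω A) ⊆ₛ A
  ^ω⊆ p A-sub x x∈pωA with x∈pωA 0
  ... | y , Ay , x≈y∙ε = IsSubgroup.resp A-sub (sym (trans x≈y∙ε (identityʳ y))) Ay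

  countable-⊆ : {A B : Subset} → B ⊆ₛ A → Countable A → Countable B
  countable-⊆ B⊆A (f , f-injective) =
    (λ (x , Bx) → f (x , B⊆A x Bx)) , λ u v → f-injective _ _

  pure-^ω-Full : {G′ : Subset} (p : ℕ) → Pure G′ Full → (p ^ω Full) ⊆ₛ G′ →
                 (p ^ω G′) ≐ (p ^ω Full)
  pure-^ω-Full {G′} p (_ , divide-in-G′) pωH⊆G′ = ^ω-mono p ⊆-Full , pωH⊆pωG′
    where
    pωH⊆pωG′ : (p ^ω Full) ⊆ₛ (p ^ω G′)
    pωH⊆pωG′ x x∈pωH n with x∈pωH n
    ... | y , _ , x≈pⁿy = divide-in-G′ (p ^ n) x y (pωH⊆G′ x x∈pωH) _ x≈pⁿy

module K1Substructures {c ℓ : Level} (H : AbelianGroup c ℓ) (p₁ p₂ : ℕ) where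
  open AG H
  open K1 p₁ p₂
  open Subsets H

  InK1-subgroup : InK1 Full → {G′ : Subset} → IsSubgroup G′ → InK1 G′
  InK1-subgroup (_ , countable₁ , countable₂) G′-sub =
    G′-sub , countable-⊆ (^ω-mono p₁ ⊆-Full) countable₁ , countable-⊆ (^ω-mono p₂ ⊆-Full) countable₂

  pure-≤K1-Full : {G′ : Subset} → Pure G′ Full →
                  (p₁ ^ω Full) ⊆ₛ G′ → (p₂ ^ω Full) ⊆ₛ G′ → G′ ≤K1 Full
  pure-≤K1-Full G′-pure p₁ωH⊆G′ p₂ωH⊆G′ =
    G′-pure , pure-^ω-Full p₁ G′-pure p₁ωH⊆G′ , inj₂ (pure-^ω-Full p₂ G′-pure p₂ωH⊆G′)

  ≤K1-Full-^ω₁⊆ : {G : Subset} → IsSubgroup G → G ≤K1 Full → (p₁ ^ω Full) ⊆ₛ G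
  ≤K1-Full-^ω₁⊆ G-sub (_ , (_ , p₁ωH⊆p₁ωG) , _) = ⊆ₛ-trans p₁ωH⊆p₁ωG (^ω⊆ p₁ G-sub)

  ≤K1-Full-^ω₂⊆ : {G : Subset} → IsSubgroup G → G ≤K1 Full → ¬ (G ≐ (p₁ ^ω G)) →
                  (p₂ ^ω Full) ⊆ₛ G
  ≤K1-Full-^ω₂⊆ _     (_ , _ , inj₁ G≐p₁ωG)         G≉p₁ωG = contradiction G≐p₁ωG G≉p₁ωG
  ≤K1-Full-^ω₂⊆ G-sub (_ , _ , inj₂ (_ , p₂ωH⊆p₂ωG)) _      = ⊆ₛ-trans p₂ωH⊆p₂ωG (^ω⊆ p₂ G-sub)

  ≤K1-Full-cases : {G′ : Subset} → IsSubgroup G′ → G′ ≤K1 Full →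
                   G′ ⊆ₛ (p₁ ^ω Full) ⊎ (p₂ ^ω Full) ⊆ₛ G′
  ≤K1-Full-cases _ (_ , (p₁ωG′⊆p₁ωH , _) , inj₁ (G′⊆p₁ωG′ , _)) =
    inj₁ (⊆ₛ-trans G′⊆p₁ωG′ p₁ωG′⊆p₁ωH)
  ≤K1-Full-cases G′-sub (_ , _ , inj₂ (_ , p₂ωH⊆p₂ωG′)) =
    inj₂ (⊆ₛ-trans p₂ωH⊆p₂ωG′ (^ω⊆ p₂ G′-sub))

  clK1⇔clTF : {A B : Subset} →
    (∀ G′ → IsSubgroup G′ → B ⊆ₛ G′ → Pure G′ Full → InK1 G′ × A ⊆ₛ G′ × G′ ≤K1 Full) →
    (∀ G′ → InK1 G′ → A ⊆ₛ G′ → G′ ≤K1 Full → B ⊆ₛ G′) →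
    ∀ x → clK1 A x ⇔ clTF B x
  clK1⇔clTF pure⇒K1 K1⇒pure x = mk⇔
    (λ x∈clK1 G′ G′-sub B⊆G′ G′-pure →
      let G′∈K1 , A⊆G′ , G′≤H = pure⇒K1 G′ G′-sub B⊆G′ G′-pure in x∈clK1 G′ G′∈K1 A⊆G′ G′≤H)
    (λ x∈clTF G′ G′∈K1 A⊆G′ G′≤H →
      x∈clTF G′ (proj₁ G′∈K1) (K1⇒pure G′ G′∈K1 A⊆G′ G′≤H) (proj₁ G′≤H))

lemma3p8 : ∀ {c ℓ : Level} (p₁ p₂ : ℕ) → Prime p₁ → Prime p₂ → p₁ ≢ p₂ →
    (H : AbelianGroup c ℓ) → AG.TorsionFree H →
    AG.K1.InK1 H p₁ p₂ (AG.Full H) →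
    (G : AG.Subset H) → AG.K1.InK1 H p₁ p₂ G → AG.K1._≤K1_ H p₁ p₂ G (AG.Full H) →
    (a : AbelianGroup.Carrier H) → ¬ G a →
    ((AG._≐_ H G (AG._^ω_ H p₁ G)) →
      ∀ x → AG.K1.clK1 H p₁ p₂ (AG._∪_ H (AG.⟨_⟩ H a) G) x
          ⇔ AG.clTF H (AG._∪_ H (AG._∪_ H (AG.⟨_⟩ H a) G) (AG._^ω_ H p₂ (AG.Full H))) x)
    × (¬ (AG._≐_ H G (AG._^ω_ H p₁ G)) →
      ∀ x → AG.K1.clK1 H p₁ p₂ (AG._∪_ H (AG.⟨_⟩ H a) G) x
          ⇔ AG.clTF H (AG._∪_ H (AG.⟨_⟩ H a) G) x)
lemma3p8 p₁ p₂ _ _ _ H _ H∈K1 G (G-sub , _) G≤H a a∉G =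
  (λ _ → clK1⇔clTF
    (λ G′ G′-sub B⊆G′ G′-pure →
      let A⊆G′ = ⊆ₛ-trans ⊆-∪ˡ B⊆G′ in
      InK1-subgroup H∈K1 G′-sub , A⊆G′ ,
      extends G′-pure (⊆ₛ-trans ⊆-∪ʳ A⊆G′) (⊆ₛ-trans ⊆-∪ʳ B⊆G′))
    (λ G′ G′∈K1 A⊆G′ G′≤H → ∪-⊆ A⊆G′ (p₂ωH⊆ G′∈K1 A⊆G′ G′≤H))) ,
  (λ G≉p₁ωG → clK1⇔clTF
    (λ G′ G′-sub A⊆G′ G′-pure →
      let G⊆G′ = ⊆ₛ-trans ⊆-∪ʳ A⊆G′ in
      InK1-subgroup H∈K1 G′-sub , A⊆G′ ,
      extends G′-pure G⊆G′ (⊆ₛ-trans (≤K1-Full-^ω₂⊆ G-sub G≤H G≉p₁ωG) G⊆G′))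
    (λ _ _ A⊆G′ _ → A⊆G′))
  where
  open AbelianGroup H using (refl)
  open AG H
  open K1 p₁ p₂
  open Subsets H
  open K1Substructures H p₁ p₂

  extends : {G′ : Subset} → Pure G′ Full → G ⊆ₛ G′ → (p₂ ^ω Full) ⊆ₛ G′ → G′ ≤K1 Full
  extends G′-pure G⊆G′ = pure-≤K1-Full G′-pure (⊆ₛ-trans (≤K1-Full-^ω₁⊆ G-sub G≤H) G⊆G′)

  p₂ωH⊆ : {G′ : Subset} → InK1 G′ → (⟨ a ⟩ ∪ G) ⊆ₛ G′ → G′ ≤K1 Full → (p₂ ^ω Full) ⊆ₛ G′
  p₂ωH⊆ (G′-sub , _) A⊆G′ G′≤H with ≤K1-Full-cases G′-sub G′≤H
  ... | inj₁ G′⊆p₁ωH =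
    contradiction (≤K1-Full-^ω₁⊆ G-sub G≤H a (G′⊆p₁ωH a (A⊆G′ a (inj₁ (lift refl))))) a∉G
  ... | inj₂ p₂ωH⊆G′ = p₂ωH⊆G′
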